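{- Let $T$ be a tree with $m$ edges and maximum degree $\Delta$, and let $t$ be the number of vertices of $T$ of degree at least $3$. Then $$N(T)\leq 2\lceil\log_2 m\rceil+\mathcal{R}(\Delta)+t.$$
   Context: $\mathcal{R}(s)=\min\{c : \binom{c}{\lfloor c/2\rfloor}\geq s\}$. For a graph $G$, a covering of $G$ is a collection of subsets $A_1,\ldots,A_n$ of $V(G)$ such that for every edge $\{u,v\}$ and every vertex $x\notin\{u,v\}$ there is some $A_j$ with $\{u,v\}\subseteq A_j$ and $x\notin A_j$; $N(G)$ is the minimum size of a covering of $G$. -}

module Defs where

open import Data.Bool using (Bool; true; false; _∧_)
open import Data.Nat using (ℕ; zero; suc; _+_; _*_; _≤_; _⊔_; _≤ᵇ_; _<ᵇ_; ⌊_/2⌋)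
open import Data.Nat.Combinatorics using (_C_)
open import Data.Fin using (Fin; toℕ)
open import Data.Fin.Subset using (Subset; _∈_; _∉_)
open import Data.List using (List; []; _∷_; _++_; length; filterᵇ; map; foldr; allFin; concatMap)
open import Data.List.Membership.Propositional using () renaming (_∈_ to _∈ₗ_)
open import Data.List.Relation.Unary.Linked using (Linked)
open import Data.List.Relation.Unary.Unique.Propositional using (Unique)
open import Data.Product using (Σ; ∃; _×_; _,_)
open import Relation.Binary.PropositionalEquality using (_≡_; _≢_)
open import Relation.Nullary using (¬_)

record Graph (n : ℕ) : Set where
  field
    adj     : Fin n → Fin n → Bool
    symm    : ∀ u v → adj u v ≡ adj v u
    irrefl  : ∀ u → adj u u ≡ false

module _ {n : ℕ} (G : Graph n) where
  open Graph G

  Adj : Fin n → Fin n → Set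
  Adj u v = adj u v ≡ true

  deg : Fin n → ℕ
  deg u = length (filterᵇ (adj u) (allFin n))

  maxDeg : ℕ
  maxDeg = foldr _⊔_ 0 (map deg (allFin n))

  edgeCount : ℕ
  edgeCount = length (filterᵇ (λ p → (toℕ (Data.Product.proj₁ p) <ᵇ toℕ (Data.Product.proj₂ p))
                                        ∧ adj (Data.Product.proj₁ p) (Data.Product.proj₂ p))
                              (concatMap (λ u → map (λ v → (u , v)) (allFin n)) (allFin n)))

  numDeg≥3 : ℕ
  numDeg≥3 = length (filterᵇ (λ u → 3 ≤ᵇ deg u) (allFin n))

  data Reach : Fin n → Fin n → Set where
    here : ∀ {u} → Reach u u
    step : ∀ {u w v} → Adj u w → Reach w v → Reach u v

  Connected : Set
  Connected = ∀ u v → Reach u v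

  HasCycle : Set
  HasCycle = Σ (Fin n) λ v → Σ (List (Fin n)) λ xs →
               (2 ≤ length xs) × Unique (v ∷ xs) × Linked Adj (v ∷ xs ++ v ∷ [])

  IsTree : Set
  IsTree = (1 ≤ n) × Connected × ¬ HasCycle

  IsCovering : List (Subset n) → Set
  IsCovering As = ∀ u v x → Adj u v → x ≢ u → x ≢ v →
                  Σ (Subset n) λ A → (A ∈ₗ As) × (u ∈ A) × (v ∈ A) × (x ∉ A)

  -- N(G) ≤ b : some covering has at most b members (N(G) is the minimum size of a covering)
  N≤ : ℕ → Set
  N≤ b = Σ (List (Subset n)) λ As → IsCovering As × (length As ≤ b)

-- IsR s c : c = R(s) = min { c : binom(c, ⌊c/2⌋) ≥ s }
IsR : ℕ → ℕ → Set
IsR s c = (s ≤ c C ⌊ c /2⌋) × (∀ c′ → s ≤ c′ C ⌊ c′ /2⌋ → c ≤ c′)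

module Submission where

-- Call a vertex low if its degree is at most 2. In a tree the low vertices induce disjoint paths, so
-- they can be listed in one sequence in which every edge between low vertices joins consecutive
-- entries. The sequence is built by inserting vertices one at a time: a vertex with two earlier
-- neighbours splices their paths together, and the two cannot lie on one path, for that would close a
-- cycle. Since n ≤ 2m ≤ 2^L with L = ⌈log₂ m⌉ + 1, the i-th low vertex can be given the i-th word of
-- the reflected Gray code of length L, so adjacent low vertices get words one bit apart. Take, for every
-- coordinate j and bit β, the set of all vertices of degree ≥ 3 and all low vertices whose word has bit
-- β at j, and, for every vertex h of degree ≥ 3, the set V ∖ {h}. For an edge uv and a vertex x off it,
-- either x has degree ≥ 3, or a coordinate separates the word of x from those of u and v (which differ
-- in at most one bit). This gives N(T) ≤ 2⌈log₂ m⌉ + 2 + t, and R(Δ) ≥ 2 as soon as Δ ≥ 2; a tree with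
-- Δ ≤ 1 has no vertex off an edge at all, so N(T) = 0.

open import Defs
open import Data.Nat using (ℕ; zero; suc; _≤_; _<_; _+_; _*_; _∸_; _^_; _⊔_; _≤ᵇ_; _<ᵇ_; _≤?_; ⌊_/2⌋; ⌈_/2⌉; z≤n; s≤s)
import Data.Nat.Properties as ℕ
open import Data.Nat.Induction using (<-rec)
open import Data.Nat.Logarithm using (⌈log₂_⌉; ⌈log₂⌈n/2⌉⌉≡⌈log₂n⌉∸1; ⌈log₂⌉-mono-≤)
open import Data.Bool using (Bool; true; false; T; not; _∧_)
import Data.Bool as Bool
open import Data.Bool.Properties using (T-∧; T-≡; ¬-not; not-¬)
open import Data.Fin using (Fin; zero; suc; toℕ; punchIn)
import Data.Fin as Fin
open import Data.Fin.Properties using (toℕ-injective; punchInᵢ≢i; ¬∀⟶∃¬)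
open import Data.Fin.Subset using (Subset; ⁅_⁆; ∁) renaming (_∈_ to _∈ₛ_; _∉_ to _∉ₛ_)
open import Data.Fin.Subset.Properties using (x∈⁅x⁆; x∈⁅y⁆⇒x≡y; x∉p⇒x∈∁p; x∈p⇒x∉∁p)
open import Data.Vec using (Vec; lookup; replicate; tabulate) renaming ([] to []ᵥ; _∷_ to _∷ᵥ_)
open import Data.Vec.Properties using (tabulate∘lookup; tabulate-cong; lookup∘tabulate; lookup⇒[]=; []=⇒lookup; ∷-injectiveʳ)
import Data.Vec.Properties as Vec
open import Data.List using (List; []; _∷_; _++_; _∷ʳ_; [_]; length; map; concat; concatMap; reverse; foldr; filter; filterᵇ; allFin)
open import Data.List.Properties using (length-++; length-++-sucʳ; length-map; length-reverse; length-tabulate; ++-assoc; map-++; reverse-++; unfold-reverse; ∷ʳ-injectiveʳ)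
open import Data.List.Reverse using (reverseView; []; _∶_∶ʳ_)
open import Data.List.Membership.Propositional using (_∈_; _∉_)
open import Data.List.Membership.Propositional.Properties using (∈-∃++; ∈-++⁻; ∈-++⁺ˡ; ∈-++⁺ʳ; ∈-concat⁺′; ∈-concat⁻′; ∈-map⁺; ∈-map⁻; ∈-filter⁺; ∈-filter⁻; ∈-allFin)
open import Data.List.Relation.Unary.Any using (Any; here; there)
import Data.List.Relation.Unary.Any as Any
open import Data.List.Relation.Unary.All as All using (All; []; _∷_)
import Data.List.Relation.Unary.All.Properties as All
open import Data.List.Relation.Unary.Linked as Linked using (Linked; []; [-]; _∷_)
import Data.List.Relation.Unary.Linked.Properties as Linked
open import Data.List.Relation.Unary.Unique.Propositional using (Unique; []; _∷_)
import Data.List.Relation.Unary.Unique.Propositional.Properties as Unique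
open import Data.List.Relation.Binary.Permutation.Propositional using (_↭_; refl; prep; swap; trans; ↭-sym; ↭-trans; ↭-swap; ↭-reflexive; ↭⇒↭ₛ)
open import Data.List.Relation.Binary.Permutation.Propositional.Properties using (All-resp-↭; Any-resp-↭; ∈-resp-↭; shift; shifts; ++⁺ˡ; ++⁺ʳ; ↭-reverse)
import Data.List.Relation.Binary.Permutation.Setoid.Properties as Permutationₛ
open import Data.Product using (∃; ∃₂; _×_; _,_; proj₁; proj₂)
import Data.Product as Product
open import Data.Sum using (_⊎_; inj₁; inj₂; [_,_]′)
import Data.Sum
open import Data.Empty using (⊥-elim)
open import Function using (_∘_; case_of_; Equivalence)
open import Relation.Binary.Definitions using (DecidableEquality; tri<; tri≈; tri>)
open import Relation.Binary.PropositionalEquality as ≡ using (_≡_; _≢_; refl; sym; cong; subst; setoid)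
open import Relation.Nullary using (¬_; Dec; yes; no)
open import Relation.Nullary.Decidable using (T?; does; dec-true; dec-false; _⊎-dec_)
open import Relation.Unary using (Decidable)

-- Duplicate-free lists and consecutive entries

module _ {A : Set} where

  Unique-resp-↭ : ∀ {xs ys : List A} → xs ↭ ys → Unique xs → Unique ys
  Unique-resp-↭ p = Permutationₛ.Unique-resp-↭ (setoid A) (↭⇒↭ₛ p)

  Unique-++⁻ˡ : ∀ (xs : List A) {ys} → Unique (xs ++ ys) → Unique xs
  Unique-++⁻ˡ []       _              = []
  Unique-++⁻ˡ (x ∷ xs) (x∉ ∷ unique) = All.++⁻ˡ xs x∉ ∷ Unique-++⁻ˡ xs unique

  Unique-++-disjoint : ∀ (xs : List A) {ys x y} → Unique (xs ++ ys) → x ∈ xs → y ∈ ys → x ≢ y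
  Unique-++-disjoint (_ ∷ xs) (x∉ ∷ _)  (here refl) y∈ys = All.lookup (All.++⁻ʳ xs x∉) y∈ys
  Unique-++-disjoint (_ ∷ xs) (_ ∷ xs!) (there x∈)  y∈ys = Unique-++-disjoint xs xs! x∈ y∈ys

  ∈-++-∷⁻ : ∀ (xs : List A) {x y ys} → y ∈ xs ++ x ∷ ys → y ≢ x → y ∈ xs ++ ys
  ∈-++-∷⁻ []       (here y≡x)  y≢x = ⊥-elim (y≢x y≡x)
  ∈-++-∷⁻ []       (there y∈)  _   = y∈
  ∈-++-∷⁻ (_ ∷ xs) (here y≡z)  _   = here y≡z
  ∈-++-∷⁻ (_ ∷ xs) (there y∈)  y≢x = there (∈-++-∷⁻ xs y∈ y≢x)

  Unique⇒length≤ : ∀ {xs ys : List A} → Unique xs → (∀ {x} → x ∈ xs → x ∈ ys) → length xs ≤ length ys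
  Unique⇒length≤ {[]}     _             _     = z≤n
  Unique⇒length≤ {x ∷ xs} (x∉xs ∷ uniq) xs⊆ys with ∈-∃++ (xs⊆ys (here refl))
  ... | ys₁ , ys₂ , refl = begin
    suc (length xs)           ≤⟨ s≤s (Unique⇒length≤ uniq xs⊆ys₁++ys₂) ⟩
    suc (length (ys₁ ++ ys₂)) ≡⟨ length-++-sucʳ ys₁ x ys₂ ⟨
    length (ys₁ ++ x ∷ ys₂)   ∎
    where
    open ℕ.≤-Reasoning
    xs⊆ys₁++ys₂ : ∀ {y} → y ∈ xs → y ∈ ys₁ ++ ys₂
    xs⊆ys₁++ys₂ y∈xs = ∈-++-∷⁻ ys₁ (xs⊆ys (there y∈xs)) (λ y≡x → All.lookup x∉xs y∈xs (sym y≡x))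

  concat-↭ : ∀ {Bs Cs : List (List A)} → Bs ↭ Cs → concat Bs ↭ concat Cs
  concat-↭ refl         = refl
  concat-↭ (prep B p)   = ++⁺ˡ B (concat-↭ p)
  concat-↭ (swap B C p) = ↭-trans (shifts B C) (++⁺ˡ C (++⁺ˡ B (concat-↭ p)))
  concat-↭ (trans p q)  = ↭-trans (concat-↭ p) (concat-↭ q)

  ∈-concat⇒↭ : ∀ (Bs : List (List A)) {x} → x ∈ concat Bs → ∃₂ λ B Rest → x ∈ B × Bs ↭ B ∷ Rest
  ∈-concat⇒↭ Bs x∈ with ∈-concat⁻′ Bs x∈
  ... | B , x∈B , B∈Bs with ∈-∃++ B∈Bs
  ... | Xs , Ys , refl = B , Xs ++ Ys , x∈B , shift B Xs Ys

  data Consecutive : List A → A → A → Set where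
    here  : ∀ {a b xs} → Consecutive (a ∷ b ∷ xs) a b
    there : ∀ {x a b xs} → Consecutive xs a b → Consecutive (x ∷ xs) a b

  Consecutive-∈ˡ : ∀ {xs a b} → Consecutive xs a b → a ∈ xs
  Consecutive-∈ˡ here      = here refl
  Consecutive-∈ˡ (there c) = there (Consecutive-∈ˡ c)

  Consecutive-∈ʳ : ∀ {xs a b} → Consecutive xs a b → b ∈ xs
  Consecutive-∈ʳ here      = there (here refl)
  Consecutive-∈ʳ (there c) = there (Consecutive-∈ʳ c)

  Consecutive-++⁺ˡ : ∀ {xs a b} ys → Consecutive xs a b → Consecutive (xs ++ ys) a b
  Consecutive-++⁺ˡ ys here      = here
  Consecutive-++⁺ˡ ys (there c) = there (Consecutive-++⁺ˡ ys c)

  Consecutive-++⁺ʳ : ∀ xs {ys a b} → Consecutive ys a b → Consecutive (xs ++ ys) a b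
  Consecutive-++⁺ʳ []       c = c
  Consecutive-++⁺ʳ (x ∷ xs) c = there (Consecutive-++⁺ʳ xs c)

  Consecutive-∷ʳ-++ : ∀ xs {a b ys} → Consecutive ((xs ∷ʳ a) ++ b ∷ ys) a b
  Consecutive-∷ʳ-++ []       = here
  Consecutive-∷ʳ-++ (x ∷ xs) = there (Consecutive-∷ʳ-++ xs)

  reverse-∷-∷ : ∀ (a b : A) xs → reverse (a ∷ b ∷ xs) ≡ reverse xs ∷ʳ b ∷ʳ a
  reverse-∷-∷ a b xs = ≡.trans (unfold-reverse a (b ∷ xs)) (cong (_∷ʳ a) (unfold-reverse b xs))

  Consecutive-reverse : ∀ {xs a b} → Consecutive xs a b → Consecutive (reverse xs) b a
  Consecutive-reverse {a ∷ b ∷ xs} here rewrite reverse-∷-∷ a b xs = Consecutive-∷ʳ-++ (reverse xs)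
  Consecutive-reverse {x ∷ xs} (there c) rewrite unfold-reverse x xs =
    Consecutive-++⁺ˡ [ x ] (Consecutive-reverse c)

  Neighbours : List A → A → A → Set
  Neighbours xs a b = Consecutive xs a b ⊎ Consecutive xs b a

  Neighbours-sym : ∀ {xs a b} → Neighbours xs a b → Neighbours xs b a
  Neighbours-sym = Data.Sum.swap

  Neighbours-++⁺ˡ : ∀ {xs a b} ys → Neighbours xs a b → Neighbours (xs ++ ys) a b
  Neighbours-++⁺ˡ ys = Data.Sum.map (Consecutive-++⁺ˡ ys) (Consecutive-++⁺ˡ ys)

  Neighbours-++⁺ʳ : ∀ xs {ys a b} → Neighbours ys a b → Neighbours (xs ++ ys) a b
  Neighbours-++⁺ʳ xs = Data.Sum.map (Consecutive-++⁺ʳ xs) (Consecutive-++⁺ʳ xs)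

  Neighbours-reverse : ∀ {xs a b} → Neighbours xs a b → Neighbours (reverse xs) a b
  Neighbours-reverse = Data.Sum.map Consecutive-reverse Consecutive-reverse ∘ Neighbours-sym

  Neighbours-concat : ∀ {Bs a b} → Any (λ B → Neighbours B a b) Bs → Neighbours (concat Bs) a b
  Neighbours-concat {B ∷ Bs} (here nb)  = Neighbours-++⁺ˡ (concat Bs) nb
  Neighbours-concat {B ∷ Bs} (there nb) = Neighbours-++⁺ʳ B (Neighbours-concat nb)

  module _ {R : A → A → Set} where

    Linked⇒Consecutive : ∀ {xs a b} → Linked R xs → Consecutive xs a b → R a b
    Linked⇒Consecutive (r ∷ _) here      = r
    Linked⇒Consecutive (_ ∷ l) (there c) = Linked⇒Consecutive l c
    Linked⇒Consecutive [-]     (there ())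

    Linked-join : ∀ xs {a ys} → Linked R (xs ∷ʳ a) → Linked R (a ∷ ys) → Linked R (xs ++ a ∷ ys)
    Linked-join []           _       l = l
    Linked-join (x ∷ [])     (r ∷ _) l = r ∷ l
    Linked-join (x ∷ y ∷ xs) (r ∷ k) l = r ∷ Linked-join (y ∷ xs) k l

    Linked-∷ʳ : ∀ xs {a b} → Linked R (xs ∷ʳ a) → R a b → Linked R (xs ∷ʳ a ∷ʳ b)
    Linked-∷ʳ xs {a} {b} l r = subst (Linked R) (sym (++-assoc xs [ a ] [ b ])) (Linked-join xs l (r ∷ [-]))

    Linked-reverse : (∀ {x y} → R x y → R y x) → ∀ {xs} → Linked R xs → Linked R (reverse xs)
    Linked-reverse R-sym []                  = []
    Linked-reverse R-sym [-]                 = [-]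
    Linked-reverse R-sym {x ∷ y ∷ xs} (r ∷ l) = subst (Linked R) (sym (reverse-∷-∷ x y xs))
      (Linked-∷ʳ (reverse xs) (subst (Linked R) (unfold-reverse y xs) (Linked-reverse R-sym l)) (R-sym r))

module Assoc {A B : Set} (_≟_ : DecidableEquality A) (default : B) where

  assoc : List A → List B → A → B
  assoc (a ∷ xs) (b ∷ ys) x with x ≟ a
  ... | yes _ = b
  ... | no  _ = assoc xs ys x
  assoc _ _ _ = default

  assoc-head : ∀ a xs b ys → assoc (a ∷ xs) (b ∷ ys) a ≡ b
  assoc-head a xs b ys with a ≟ a
  ... | yes _   = refl
  ... | no  a≢a = ⊥-elim (a≢a refl)

  assoc-tail : ∀ {x} a xs b ys → x ≢ a → assoc (a ∷ xs) (b ∷ ys) x ≡ assoc xs ys x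
  assoc-tail {x} a xs b ys x≢a with x ≟ a
  ... | yes x≡a = ⊥-elim (x≢a x≡a)
  ... | no  _   = refl

  assoc-∈ : ∀ {x} xs ys → length xs ≤ length ys → x ∈ xs → assoc xs ys x ∈ ys
  assoc-∈ {x} (a ∷ xs) (b ∷ ys) (s≤s len) x∈ with x ≟ a
  ... | yes _   = here refl
  ... | no  x≢a = there (assoc-∈ xs ys len (Any.tail x≢a x∈))

  assoc-injective : ∀ {x y} xs ys → length xs ≤ length ys → Unique xs → Unique ys →
                    x ∈ xs → y ∈ xs → x ≢ y → assoc xs ys x ≢ assoc xs ys y
  assoc-injective {x} {y} (a ∷ xs) (b ∷ ys) (s≤s len) (_ ∷ xs!) (b∉ys ∷ ys!) x∈ y∈ x≢y
    with x ≟ a | y ≟ a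
  ... | yes refl | yes refl = ⊥-elim (x≢y refl)
  ... | yes refl | no  y≢a  = λ b≡ → All.lookup b∉ys (assoc-∈ xs ys len (Any.tail y≢a y∈)) b≡
  ... | no  x≢a  | yes refl = λ ≡b → All.lookup b∉ys (assoc-∈ xs ys len (Any.tail x≢a x∈)) (sym ≡b)
  ... | no  x≢a  | no  y≢a  =
    assoc-injective xs ys len xs! ys! (Any.tail x≢a x∈) (Any.tail y≢a y∈) x≢y

  assoc-consecutive : ∀ {x y} xs ys → length xs ≤ length ys → Unique xs →
                      Consecutive xs x y → Consecutive ys (assoc xs ys x) (assoc xs ys y)
  assoc-consecutive (x ∷ y ∷ xs) (b ∷ b′ ∷ ys) _ ((x≢y ∷ _) ∷ _) here
    rewrite assoc-head x (y ∷ xs) b (b′ ∷ ys) | assoc-tail x (y ∷ xs) b (b′ ∷ ys) (x≢y ∘ sym)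
          | assoc-head y xs b′ ys = here
  assoc-consecutive {x} {y} (a ∷ xs) (b ∷ ys) (s≤s len) (a∉xs ∷ xs!) (there c)
    rewrite assoc-tail a xs b ys (λ x≡a → All.lookup a∉xs (Consecutive-∈ˡ c) (sym x≡a))
          | assoc-tail a xs b ys (λ y≡a → All.lookup a∉xs (Consecutive-∈ʳ c) (sym y≡a)) =
    there (assoc-consecutive xs ys len xs! c)

-- Gray codes

2^l+2^l≡2^[1+l] : ∀ l → 2 ^ l + 2 ^ l ≡ 2 ^ suc l
2^l+2^l≡2^[1+l] l = cong (2 ^ l +_) (sym (ℕ.+-identityʳ (2 ^ l)))

data OneBitApart : ∀ {L} → Vec Bool L → Vec Bool L → Set where
  flipHead : ∀ {L b b′} {xs : Vec Bool L} → b ≢ b′ → OneBitApart (b ∷ᵥ xs) (b′ ∷ᵥ xs)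
  keepHead : ∀ {L b} {xs ys : Vec Bool L} → OneBitApart xs ys → OneBitApart (b ∷ᵥ xs) (b ∷ᵥ ys)

OneBitApart-sym : ∀ {L} {x y : Vec Bool L} → OneBitApart x y → OneBitApart y x
OneBitApart-sym (flipHead b≢b′) = flipHead (b≢b′ ∘ sym)
OneBitApart-sym (keepHead d)    = keepHead (OneBitApart-sym d)

gray : (L : ℕ) → List (Vec Bool L)
gray zero    = [ []ᵥ ]
gray (suc L) = map (false ∷ᵥ_) (gray L) ++ map (true ∷ᵥ_) (reverse (gray L))

length-gray : ∀ L → length (gray L) ≡ 2 ^ L
length-gray zero    = refl
length-gray (suc L) = begin
  length (map (false ∷ᵥ_) (gray L) ++ map (true ∷ᵥ_) (reverse (gray L)))
    ≡⟨ length-++ (map (false ∷ᵥ_) (gray L)) ⟩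
  length (map (false ∷ᵥ_) (gray L)) + length (map (true ∷ᵥ_) (reverse (gray L)))
    ≡⟨ ≡.cong₂ _+_ (length-map _ (gray L)) (≡.trans (length-map _ (reverse (gray L))) (length-reverse (gray L))) ⟩
  length (gray L) + length (gray L)
    ≡⟨ cong (λ m → m + m) (length-gray L) ⟩
  2 ^ L + 2 ^ L
    ≡⟨ 2^l+2^l≡2^[1+l] L ⟩
  2 ^ suc L ∎
  where open ≡.≡-Reasoning

gray-nonempty : ∀ L → gray L ≢ []
gray-nonempty L gray≡[] = ℕ.<⇒≢ (ℕ.m^n>0 2 L) (≡.trans (sym (cong length gray≡[])) (length-gray L))

gray-unique : ∀ L → Unique (gray L)
gray-unique zero    = [] ∷ []
gray-unique (suc L) = Unique.++⁺ (Unique.map⁺ ∷-injectiveʳ (gray-unique L))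
  (Unique.map⁺ ∷-injectiveʳ (Unique-resp-↭ (↭-sym (↭-reverse (gray L))) (gray-unique L)))
  heads-differ
  where
  heads-differ : ∀ {v} → ¬ (v ∈ map (false ∷ᵥ_) (gray L) × v ∈ map (true ∷ᵥ_) (reverse (gray L)))
  heads-differ (v∈₀ , v∈₁) with ∈-map⁻ (false ∷ᵥ_) v∈₀ | ∈-map⁻ (true ∷ᵥ_) v∈₁
  ... | _ , _ , refl | _ , _ , ()

Linked-map-∷ : ∀ {L} b {xs : List (Vec Bool L)} → Linked OneBitApart xs → Linked OneBitApart (map (b ∷ᵥ_) xs)
Linked-map-∷ b l = Linked.map⁺ (Linked.map keepHead l)

Linked-reflect : ∀ {L} (xs : List (Vec Bool L)) → xs ≢ [] → Linked OneBitApart xs →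
                 Linked OneBitApart (map (false ∷ᵥ_) xs ++ map (true ∷ᵥ_) (reverse xs))
Linked-reflect xs xs≢[] l with reverseView xs
... | []           = ⊥-elim (xs≢[] refl)
... | ys ∶ _ ∶ʳ z
  rewrite reverse-++ ys [ z ] | map-++ (false ∷ᵥ_) ys [ z ]
        | ++-assoc (map (false ∷ᵥ_) ys) [ false ∷ᵥ z ] (map (true ∷ᵥ_) (z ∷ reverse ys)) =
  Linked-join (map (false ∷ᵥ_) ys) first-half (flipHead (λ ()) ∷ Linked-map-∷ true second-half)
  where
  first-half : Linked OneBitApart (map (false ∷ᵥ_) ys ∷ʳ (false ∷ᵥ z))
  first-half = subst (Linked OneBitApart) (map-++ _ ys [ z ]) (Linked-map-∷ false l)
  second-half : Linked OneBitApart (z ∷ reverse ys)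
  second-half = subst (Linked OneBitApart) (reverse-++ ys [ z ]) (Linked-reverse OneBitApart-sym l)

gray-linked : ∀ L → Linked OneBitApart (gray L)
gray-linked zero    = [-]
gray-linked (suc L) = Linked-reflect (gray L) (gray-nonempty L) (gray-linked L)

lookup-≢ : ∀ {L} {x y : Vec Bool L} → x ≢ y → ∃ λ j → lookup x j ≢ lookup y j
lookup-≢ {L} {x} {y} x≢y =
  ¬∀⟶∃¬ L (λ j → lookup x j ≡ lookup y j) (λ j → lookup x j Bool.≟ lookup y j) (x≢y ∘ lookup-ext)
  where
  lookup-ext : (∀ j → lookup x j ≡ lookup y j) → x ≡ y
  lookup-ext eq = ≡.trans (sym (tabulate∘lookup x)) (≡.trans (tabulate-cong eq) (tabulate∘lookup y))

OneBitApart-separates : ∀ {L} {a b : Vec Bool L} x → OneBitApart a b → x ≢ a → x ≢ b →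
                        ∃ λ j → lookup a j ≡ lookup b j × lookup x j ≢ lookup a j
OneBitApart-separates {a = c ∷ᵥ t} (d ∷ᵥ x) (flipHead c≢c′) x≢a x≢b with Vec.≡-dec Bool._≟_ x t
-- Here x = d ∷ t, and d, c, c′ would be three distinct Booleans.
... | yes refl = ⊥-elim (x≢b (cong (_∷ᵥ x) (≡.trans (¬-not (x≢a ∘ cong (_∷ᵥ x)))
                                                   (sym (¬-not (c≢c′ ∘ sym))))))
... | no x≢t with lookup-≢ x≢t
...   | j , differ = suc j , refl , differ
OneBitApart-separates {a = c ∷ᵥ t} (d ∷ᵥ x) (keepHead apart) x≢a x≢b with d Bool.≟ c
... | no d≢c  = zero , refl , d≢c
... | yes refl with OneBitApart-separates x apart (x≢a ∘ cong (d ∷ᵥ_)) (x≢b ∘ cong (d ∷ᵥ_))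
...   | j , agree , differ = suc j , agree , differ


⟦_⟧ : ∀ {n} {P : Fin n → Set} → Decidable P → Subset n
⟦ P? ⟧ = tabulate (does ∘ P?)

∈⟦⟧ : ∀ {n} {P : Fin n → Set} (P? : Decidable P) {x} → P x → x ∈ₛ ⟦ P? ⟧
∈⟦⟧ P? {x} px = lookup⇒[]= x _ (≡.trans (lookup∘tabulate _ x) (dec-true (P? x) px))

∉⟦⟧ : ∀ {n} {P : Fin n → Set} (P? : Decidable P) {x} → ¬ P x → x ∉ₛ ⟦ P? ⟧
∉⟦⟧ P? {x} ¬px x∈ with ≡.trans (sym ([]=⇒lookup x∈)) (≡.trans (lookup∘tabulate _ x) (dec-false (P? x) ¬px))
... | ()

module _ {n : ℕ} (G : Graph n) where
  open Graph G
  open import Data.List.Membership.DecPropositional (Fin._≟_ {n}) using (_∈?_)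

  infix 4 _~_ _~?_
  _~_ : Fin n → Fin n → Set
  _~_ = Adj G

  _~?_ : ∀ u v → Dec (u ~ v)
  u ~? v = adj u v Bool.≟ true

  ~-sym : ∀ {u v} → u ~ v → v ~ u
  ~-sym {u} {v} u~v = ≡.trans (symm v u) u~v

  ~-irrefl : ∀ {u v} → u ~ v → u ≢ v
  ~-irrefl {u} u~u refl with ≡.trans (sym u~u) (irrefl u)
  ... | ()

  deg-≥ : ∀ {u ys} → Unique ys → All (u ~_) ys → length ys ≤ deg G u
  deg-≥ {u} ys! u~ys = Unique⇒length≤ ys!
    (λ {y} y∈ys → ∈-filter⁺ (T? ∘ adj u) (∈-allFin y) (Equivalence.from T-≡ (All.lookup u~ys y∈ys)))

  Low : Fin n → Set
  Low u = deg G u ≤ 2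

  three-neighbours⇒¬Low : ∀ {a x y z} → a ~ x → a ~ y → a ~ z → x ≢ y → x ≢ z → y ≢ z → ¬ Low a
  three-neighbours⇒¬Low a~x a~y a~z x≢y x≢z y≢z low
    with ℕ.≤-trans (deg-≥ ((x≢y ∷ x≢z ∷ []) ∷ (y≢z ∷ []) ∷ [] ∷ []) (a~x ∷ a~y ∷ a~z ∷ [])) low
  ... | s≤s (s≤s ())

  interior-¬Low : ∀ p {y a z q w} → let B = (p ∷ʳ y) ++ a ∷ z ∷ q in
                  Linked _~_ B → Unique B → w ∉ B → a ~ w → ¬ Low a
  interior-¬Low p {y} {a} {z} {q} {w} l B! w∉B a~w = three-neighbours⇒¬Low
    (~-sym (Linked⇒Consecutive l (Consecutive-∷ʳ-++ p))) (Linked⇒Consecutive l (Consecutive-++⁺ʳ (p ∷ʳ y) here)) a~w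
    (Unique-++-disjoint (p ∷ʳ y) B! y∈ (there (here refl))) (λ y≡w → w∉B (subst (_∈ _) y≡w (∈-++⁺ˡ y∈)))
    (λ z≡w → w∉B (subst (_∈ _) z≡w (∈-++⁺ʳ (p ∷ʳ y) (there (here refl)))))
    where
    y∈ : y ∈ p ∷ʳ y
    y∈ = ∈-++⁺ʳ p (here refl)

  endpoint : ∀ {B a w} → Linked _~_ B → Unique B → a ∈ B → Low a → w ∉ B → a ~ w →
             (∃ λ C → B ≡ a ∷ C) ⊎ (∃ λ C → B ≡ C ∷ʳ a)
  endpoint l B! a∈B low w∉B a~w with ∈-∃++ a∈B
  ... | ps , [] , refl = inj₂ (ps , refl)
  ... | ps , z ∷ q , refl with reverseView ps
  ...   | []         = inj₁ (z ∷ q , refl)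
  ...   | p ∶ _ ∶ʳ y = ⊥-elim (interior-¬Low p l B! w∉B a~w low)

  -- Listing the vertices of degree at most 2 path by path

  record PathCover (S : List (Fin n)) (Bs : List (List (Fin n))) : Set where
    field
      partition : concat Bs ↭ S
      unique    : Unique S
      low       : All Low S
      paths     : All (Linked _~_) Bs
      edges     : ∀ {u v} → u ∈ S → v ∈ S → u ~ v → Any (λ B → Neighbours B u v) Bs

  open PathCover

  PathCover-[] : PathCover [] []
  PathCover-[] = record { partition = refl ; unique = [] ; low = [] ; paths = [] ; edges = λ () }

  PathCover-resp-↭ : ∀ {S Bs Cs} → Bs ↭ Cs → PathCover S Bs → PathCover S Cs
  PathCover-resp-↭ Bs↭Cs pc = record
    { unique    = unique pc
    ; low       = low pc
    ; partition = ↭-trans (concat-↭ (↭-sym Bs↭Cs)) (partition pc)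
    ; paths     = All-resp-↭ Bs↭Cs (paths pc)
    ; edges     = λ u∈ v∈ u~v → Any-resp-↭ Bs↭Cs (edges pc u∈ v∈ u~v)
    }

  PathCover-reverse : ∀ {S B Bs} → PathCover S (B ∷ Bs) → PathCover S (reverse B ∷ Bs)
  PathCover-reverse {B = B} {Bs} pc = record
    { unique    = unique pc
    ; low       = low pc
    ; partition = ↭-trans (++⁺ʳ (concat Bs) (↭-reverse B)) (partition pc)
    ; paths     = Linked-reverse ~-sym (All.head (paths pc)) ∷ All.tail (paths pc)
    ; edges     = edges′
    }
    where
    edges′ : ∀ {u v} → u ∈ _ → v ∈ _ → u ~ v → Any (λ C → Neighbours C u v) (reverse B ∷ Bs)
    edges′ u∈ v∈ u~v with edges pc u∈ v∈ u~v
    ... | here nb  = here (Neighbours-reverse nb)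
    ... | there nb = there nb

  PathCover-[]∷ : ∀ {S Bs} → PathCover S Bs → PathCover S ([] ∷ Bs)
  PathCover-[]∷ pc = record
    { partition = partition pc
    ; unique    = unique pc
    ; low       = low pc
    ; paths     = [] ∷ paths pc
    ; edges     = λ u∈ v∈ u~v → there (edges pc u∈ v∈ u~v)
    }

  head-⊆ : ∀ {S B Bs x} → PathCover S (B ∷ Bs) → x ∈ B → x ∈ S
  head-⊆ pc x∈B = ∈-resp-↭ (partition pc) (∈-++⁺ˡ x∈B)

  head-unique : ∀ {S B Bs} → PathCover S (B ∷ Bs) → Unique B
  head-unique {B = B} pc = Unique-++⁻ˡ B (Unique-resp-↭ (↭-sym (partition pc)) (unique pc))

  bringToFront : ∀ {S x} Cs {Bs} → PathCover S (Cs ++ Bs) → x ∈ concat Bs →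
                 ∃₂ λ B Rest → x ∈ B × PathCover S (B ∷ Cs ++ Rest)
  bringToFront Cs {Bs} pc x∈ with ∈-concat⇒↭ Bs x∈
  ... | B , Rest , x∈B , Bs↭ = B , Rest , x∈B , PathCover-resp-↭ (↭-trans (++⁺ˡ Cs Bs↭) (shift B Cs Rest)) pc

  orient-head : ∀ {S B Bs a w} → PathCover S (B ∷ Bs) → a ∈ B → w ∉ S → a ~ w →
                ∃ λ C → PathCover S ((a ∷ C) ∷ Bs)
  orient-head pc a∈B w∉S a~w
    with endpoint (All.head (paths pc)) (head-unique pc) a∈B (All.lookup (low pc) (head-⊆ pc a∈B)) (w∉S ∘ head-⊆ pc) a~w
  ... | inj₁ (C , refl) = C , pc
  ... | inj₂ (C , refl) = reverse C , subst (λ B → PathCover _ (B ∷ _)) (reverse-++ C [ _ ]) (PathCover-reverse pc)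

  orient-last : ∀ {S B Bs a w} → PathCover S (B ∷ Bs) → a ∈ B → w ∉ S → a ~ w →
                ∃ λ C → PathCover S ((C ∷ʳ a) ∷ Bs)
  orient-last pc a∈B w∉S a~w with orient-head pc a∈B w∉S a~w
  ... | C , pc′ = reverse C , subst (λ B → PathCover _ (B ∷ _)) (unfold-reverse _ C) (PathCover-reverse pc′)

  splice : ∀ {S L R Bs w} → PathCover S (L ∷ R ∷ Bs) → Low w → w ∉ S →
           Linked _~_ (L ∷ʳ w) → Linked _~_ (w ∷ R) →
           (∀ {v} → v ∈ S → w ~ v → Neighbours (L ++ w ∷ R) w v) →
           PathCover (w ∷ S) ((L ++ w ∷ R) ∷ Bs)
  splice {S} {L} {R} {Bs} {w} pc low-w w∉S Lw wR w-edges = record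
    { partition = ↭-trans (↭-reflexive (++-assoc L (w ∷ R) (concat Bs)))
                    (↭-trans (shift w L (R ++ concat Bs)) (prep w (partition pc)))
    ; unique    = All.¬Any⇒All¬ S w∉S ∷ unique pc
    ; low       = low-w ∷ low pc
    ; paths     = Linked-join L Lw wR ∷ All.tail (All.tail (paths pc))
    ; edges     = edges′
    }
    where
    edges′ : ∀ {u v} → u ∈ w ∷ S → v ∈ w ∷ S → u ~ v → Any (λ B → Neighbours B u v) ((L ++ w ∷ R) ∷ Bs)
    edges′ (here refl) (here refl) u~v = ⊥-elim (~-irrefl u~v refl)
    edges′ (here refl) (there v∈)  u~v = here (w-edges v∈ u~v)
    edges′ (there u∈)  (here refl) u~v = here (Neighbours-sym (w-edges u∈ (~-sym u~v)))
    edges′ (there u∈)  (there v∈)  u~v with edges pc u∈ v∈ u~v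
    ... | here nb          = here (Neighbours-++⁺ˡ (w ∷ R) nb)
    ... | there (here nb)  = here (Neighbours-++⁺ʳ L (Neighbours-++⁺ʳ [ w ] nb))
    ... | there (there nb) = there nb

  closePath : ∀ {C D a b w} → C ∷ʳ a ≡ b ∷ D → a ≢ b → Linked _~_ (C ∷ʳ a) → Unique (C ∷ʳ a) →
              w ∉ C ∷ʳ a → w ~ a → w ~ b → HasCycle G
  closePath {[]}    refl a≢b _ _ _ _ _ = ⊥-elim (a≢b refl)
  closePath {c ∷ C} {D} {a} {b} {w} eq a≢b l Ca! w∉ w~a w~b =
    w , (c ∷ C) ∷ʳ a , length≥2 , All.¬Any⇒All¬ _ w∉ ∷ Ca! ,
    subst (λ B → Linked _~_ (w ∷ B ∷ʳ w)) (sym eq)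
      (w~b ∷ subst (λ B → Linked _~_ (B ∷ʳ w)) eq (Linked-∷ʳ (c ∷ C) l (~-sym w~a)))
    where
    length≥2 : 2 ≤ length ((c ∷ C) ∷ʳ a)
    length≥2 rewrite length-++-sucʳ C a [] = s≤s (s≤s z≤n)

  insert-isolated : ∀ {S Bs w} → PathCover S Bs → Low w → w ∉ S → (∀ {v} → v ∈ S → ¬ w ~ v) →
                    PathCover (w ∷ S) ([ w ] ∷ Bs)
  insert-isolated pc low-w w∉S isolated =
    splice (PathCover-[]∷ (PathCover-[]∷ pc)) low-w w∉S [-] [-] (λ v∈ w~v → ⊥-elim (isolated v∈ w~v))

  insert-pendant : ∀ {S Bs w a} → PathCover S Bs → Low w → w ∉ S → a ∈ S → w ~ a →
                   (∀ {v} → v ∈ S → w ~ v → v ≡ a) → ∃ λ Bs′ → PathCover (w ∷ S) Bs′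
  insert-pendant {w = w} pc low-w w∉S a∈S w~a only-a with bringToFront [] pc (∈-resp-↭ (↭-sym (partition pc)) a∈S)
  ... | B , Bs , a∈B , pc₁ with orient-head pc₁ a∈B w∉S (~-sym w~a)
  ... | C , pc₂ = _ , splice (PathCover-[]∷ pc₂) low-w w∉S [-] (w~a ∷ All.head (paths pc₂)) w-edges
    where
    w-edges : ∀ {v} → v ∈ _ → w ~ v → Neighbours (w ∷ _ ∷ C) _ v
    w-edges v∈ w~v rewrite only-a v∈ w~v = inj₁ here

  module _ (acyclic : ¬ HasCycle G) where

    insert-bridge : ∀ {S Bs w a b} → PathCover S Bs → Low w → w ∉ S → a ∈ S → b ∈ S → w ~ a → w ~ b → a ≢ b →
                    (∀ {v} → v ∈ S → w ~ v → v ≡ a ⊎ v ≡ b) → ∃ λ Bs′ → PathCover (w ∷ S) Bs′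
    insert-bridge {w = w} {a} {b} pc low-w w∉S a∈S b∈S w~a w~b a≢b only-ab
      with bringToFront [] pc (∈-resp-↭ (↭-sym (partition pc)) a∈S)
    ... | B₁ , _ , a∈B₁ , pc₁ with orient-last pc₁ a∈B₁ w∉S (~-sym w~a)
    ... | C₁ , pc₂ with ∈-++⁻ (C₁ ∷ʳ a) (∈-resp-↭ (↭-sym (partition pc₂)) b∈S)
    ... | inj₁ b∈C₁a = ⊥-elim (acyclic (same-path b∈C₁a))
      where
      same-path : b ∈ C₁ ∷ʳ a → HasCycle G
      same-path b∈ with endpoint (All.head (paths pc₂)) (head-unique pc₂) b∈ (All.lookup (low pc₂) b∈S)
                                 (w∉S ∘ head-⊆ pc₂) (~-sym w~b)
      ... | inj₁ (D , eq) = closePath eq a≢b (All.head (paths pc₂)) (head-unique pc₂) (w∉S ∘ head-⊆ pc₂) w~a w~b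
      ... | inj₂ (D , eq) = ⊥-elim (a≢b (∷ʳ-injectiveʳ C₁ D eq))
    ... | inj₂ b∈Bs₁ with bringToFront [ C₁ ∷ʳ a ] pc₂ b∈Bs₁
    ... | B₂ , _ , b∈B₂ , pc₃ with orient-head pc₃ b∈B₂ w∉S (~-sym w~b)
    ... | C₂ , pc₄ = _ , splice (PathCover-resp-↭ (↭-swap _ _ refl) pc₄) low-w w∉S
                           (Linked-∷ʳ C₁ (All.head (paths pc₂)) (~-sym w~a)) (w~b ∷ All.head (paths pc₄)) w-edges
      where
      w-edges : ∀ {v} → v ∈ _ → w ~ v → Neighbours ((C₁ ∷ʳ a) ++ w ∷ b ∷ C₂) w v
      w-edges v∈ w~v with only-ab v∈ w~v
      ... | inj₁ refl = inj₂ (Consecutive-∷ʳ-++ C₁)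
      ... | inj₂ refl = inj₁ (Consecutive-++⁺ʳ (C₁ ∷ʳ a) here)

    insert : ∀ {S Bs w} → PathCover S Bs → Low w → w ∉ S → ∃ λ Bs′ → PathCover (w ∷ S) Bs′
    insert {S} {w = w} pc low-w w∉S = attach (filter (w ~?_) S) (∈-filter⁻ (w ~?_)) (∈-filter⁺ (w ~?_))
                                            (Unique.filter⁺ (w ~?_) (unique pc))
      where
      attach : ∀ Ns → (∀ {v} → v ∈ Ns → v ∈ S × w ~ v) → (∀ {v} → v ∈ S → w ~ v → v ∈ Ns) → Unique Ns →
               ∃ λ Bs′ → PathCover (w ∷ S) Bs′
      attach [] _ complete _ = _ , insert-isolated pc low-w w∉S (λ v∈ w~v → case complete v∈ w~v of λ ())
      attach (a ∷ []) sound complete _ =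
        insert-pendant pc low-w w∉S (proj₁ a-ok) (proj₂ a-ok) (λ v∈ w~v → only (complete v∈ w~v))
        where
        a-ok : a ∈ S × w ~ a
        a-ok = sound (here refl)
        only : ∀ {v} → v ∈ [ a ] → v ≡ a
        only (here v≡a) = v≡a
      attach (a ∷ b ∷ []) sound complete ((a≢b ∷ []) ∷ _) =
        insert-bridge pc low-w w∉S (proj₁ a-ok) (proj₁ b-ok) (proj₂ a-ok) (proj₂ b-ok) a≢b
                      (λ v∈ w~v → only (complete v∈ w~v))
        where
        a-ok : a ∈ S × w ~ a
        a-ok = sound (here refl)
        b-ok : b ∈ S × w ~ b
        b-ok = sound (there (here refl))
        only : ∀ {v} → v ∈ a ∷ b ∷ [] → v ≡ a ⊎ v ≡ b
        only (here v≡a)         = inj₁ v≡a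
        only (there (here v≡b)) = inj₂ v≡b
      attach (a ∷ b ∷ c ∷ _) sound _ ((a≢b ∷ a≢c ∷ _) ∷ (b≢c ∷ _) ∷ _) =
        ⊥-elim (three-neighbours⇒¬Low (proj₂ (sound (here refl))) (proj₂ (sound (there (here refl))))
                           (proj₂ (sound (there (there (here refl))))) a≢b a≢c b≢c low-w)

    lowPathCover : ∀ (vs : List (Fin n)) → ∃₂ λ S Bs → PathCover S Bs × (∀ {v} → v ∈ vs → Low v → v ∈ S)
    lowPathCover []       = [] , [] , PathCover-[] , λ ()
    lowPathCover (v ∷ vs) with lowPathCover vs
    ... | S , Bs , pc , covers with deg G v ≤? 2 | v ∈? S
    ... | no ¬low  | _       = S , Bs , pc , λ { (here refl) low → ⊥-elim (¬low low) ; (there u∈) → covers u∈ }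
    ... | yes _    | yes v∈S = S , Bs , pc , λ { (here refl) _ → v∈S ; (there u∈) → covers u∈ }
    ... | yes low  | no v∉S with insert pc low v∉S
    ...   | Bs′ , pc′ = v ∷ S , Bs′ , pc′ , λ { (here refl) _ → here refl ; (there u∈) low → there (covers u∈ low) }

    lowPathOrder : ∃ λ P → Unique P × (∀ {v} → Low v → v ∈ P) ×
                           (∀ {u v} → Low u → Low v → u ~ v → Neighbours P u v)
    lowPathOrder with lowPathCover (allFin n)
    ... | S , Bs , pc , covers = concat Bs , Unique-resp-↭ (↭-sym (partition pc)) (unique pc) , complete , consecutive
      where
      complete : ∀ {v} → Low v → v ∈ concat Bs
      complete low = ∈-resp-↭ (↭-sym (partition pc)) (covers (∈-allFin _) low)
      consecutive : ∀ {u v} → Low u → Low v → u ~ v → Neighbours (concat Bs) u v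
      consecutive lu lv u~v = Neighbours-concat (edges pc (covers (∈-allFin _) lu) (covers (∈-allFin _) lv) u~v)

  record CubeEmbedding (L : ℕ) : Set where
    field
      code      : Fin n → Vec Bool L
      injective : ∀ {u v} → Low u → Low v → u ≢ v → code u ≢ code v
      adjacent  : ∀ {u v} → Low u → Low v → u ~ v → OneBitApart (code u) (code v)

  -- Number the low vertices along the path order and give the i-th one the i-th Gray code word.
  cubeEmbedding : ∀ {L} → ¬ HasCycle G → n ≤ 2 ^ L → CubeEmbedding L
  cubeEmbedding {L} acyclic n≤2^L with lowPathOrder acyclic
  ... | P , P! , complete , consecutive = record
    { code      = code
    ; injective = λ lu lv → assoc-injective P (gray L) P≤gray P! (gray-unique L) (complete lu) (complete lv)
    ; adjacent  = adjacent
    }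
    where
    open Assoc Fin._≟_ (replicate L false)
    code : Fin n → Vec Bool L
    code = assoc P (gray L)
    P≤gray : length P ≤ length (gray L)
    P≤gray = begin
      length P          ≤⟨ Unique⇒length≤ P! (λ _ → ∈-allFin _) ⟩
      length (allFin n) ≡⟨ length-tabulate (λ i → i) ⟩
      n                 ≤⟨ n≤2^L ⟩
      2 ^ L             ≡⟨ length-gray L ⟨
      length (gray L)   ∎
      where open ℕ.≤-Reasoning
    gray-step : ∀ {u v} → Consecutive P u v → OneBitApart (code u) (code v)
    gray-step c = Linked⇒Consecutive (gray-linked L) (assoc-consecutive P (gray L) P≤gray P! c)
    adjacent : ∀ {u v} → Low u → Low v → u ~ v → OneBitApart (code u) (code v)
    adjacent lu lv u~v with consecutive lu lv u~v
    ... | inj₁ c = gray-step c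
    ... | inj₂ c = OneBitApart-sym (gray-step c)

  -- The covering

  High : Fin n → Set
  High u = T (3 ≤ᵇ deg G u)

  high? : Decidable High
  high? u = T? (3 ≤ᵇ deg G u)

  ¬High⇒Low : ∀ {u} → ¬ High u → Low u
  ¬High⇒Low ¬high = ℕ.≤-pred (ℕ.≰⇒> (¬high ∘ ℕ.≤⇒≤ᵇ))

  -- At least one coordinate is needed, for edges whose ends both have degree ≥ 3.
  module _ {K : ℕ} (E : CubeEmbedding (suc K)) where
    open CubeEmbedding E

    Member : Fin (suc K) → Bool → Fin n → Set
    Member j β w = High w ⊎ lookup (code w) j ≡ β

    separating : ∀ {u v x} → u ~ v → x ≢ u → x ≢ v → ¬ High x →
                 ∃₂ λ j β → Member j β u × Member j β v × ¬ Member j β x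
    separating {u} {v} {x} u~v x≢u x≢v ¬hx with high? u | high? v
    ... | yes hu | yes hv = zero , not (lookup (code x) zero) , inj₁ hu , inj₁ hv , [ ¬hx , not-¬ refl ]′
    ... | no ¬hu | yes hv with lookup-≢ (injective (¬High⇒Low ¬hu) (¬High⇒Low ¬hx) (x≢u ∘ sym))
    ...   | j , u≢xⱼ = j , lookup (code u) j , inj₂ refl , inj₁ hv , [ ¬hx , u≢xⱼ ∘ sym ]′
    separating {u} {v} {x} u~v x≢u x≢v ¬hx | yes hu | no ¬hv
      with lookup-≢ (injective (¬High⇒Low ¬hv) (¬High⇒Low ¬hx) (x≢v ∘ sym))
    ...   | j , v≢xⱼ = j , lookup (code v) j , inj₁ hu , inj₂ refl , [ ¬hx , v≢xⱼ ∘ sym ]′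
    separating {u} {v} {x} u~v x≢u x≢v ¬hx | no ¬hu | no ¬hv
      with OneBitApart-separates (code x) (adjacent (¬High⇒Low ¬hu) (¬High⇒Low ¬hv) u~v)
             (injective (¬High⇒Low ¬hx) (¬High⇒Low ¬hu) x≢u) (injective (¬High⇒Low ¬hx) (¬High⇒Low ¬hv) x≢v)
    ...   | j , agree , x≢uⱼ = j , lookup (code u) j , inj₂ refl , inj₂ (sym agree) , [ ¬hx , x≢uⱼ ]′

    member? : ∀ j β → Decidable (Member j β)
    member? j β w = high? w ⊎-dec (lookup (code w) j Bool.≟ β)

    cubeSet : Bool → Fin (suc K) → Subset n
    cubeSet β j = ⟦ member? j β ⟧

    cubeSets : Bool → List (Subset n)
    cubeSets β = map (cubeSet β) (allFin (suc K))

    highVertices : List (Fin n)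
    highVertices = filter high? (allFin n)

    sets : List (Subset n)
    sets = cubeSets false ++ cubeSets true ++ map (∁ ∘ ⁅_⁆) highVertices

    sets-covering : IsCovering G sets
    sets-covering u v x u~v x≢u x≢v with high? x
    ... | yes hx = ∁ ⁅ x ⁆ , ∈-++⁺ʳ (cubeSets false) (∈-++⁺ʳ (cubeSets true)
                     (∈-map⁺ (∁ ∘ ⁅_⁆) (∈-filter⁺ high? (∈-allFin x) hx))) ,
                   x∉p⇒x∈∁p (x≢u ∘ sym ∘ x∈⁅y⁆⇒x≡y x) , x∉p⇒x∈∁p (x≢v ∘ sym ∘ x∈⁅y⁆⇒x≡y x) , x∈p⇒x∉∁p (x∈⁅x⁆ x)
    ... | no ¬hx with separating u~v x≢u x≢v ¬hx
    ...   | j , β , mu , mv , ¬mx =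
      cubeSet β j , set∈ β , ∈⟦⟧ (member? j β) mu , ∈⟦⟧ (member? j β) mv , ∉⟦⟧ (member? j β) ¬mx
      where
      set∈ : ∀ β → cubeSet β j ∈ sets
      set∈ false = ∈-++⁺ˡ (∈-map⁺ (cubeSet false) (∈-allFin j))
      set∈ true  = ∈-++⁺ʳ (cubeSets false) (∈-++⁺ˡ (∈-map⁺ (cubeSet true) (∈-allFin j)))

    length-cubeSets : ∀ β → length (cubeSets β) ≡ suc K
    length-cubeSets β = ≡.trans (length-map (cubeSet β) (allFin (suc K))) (length-tabulate (λ i → i))

    length-sets : length sets ≡ 2 * suc K + numDeg≥3 G
    length-sets = begin
      length sets
        ≡⟨ length-++ (cubeSets false) ⟩
      length (cubeSets false) + length (cubeSets true ++ map (∁ ∘ ⁅_⁆) highVertices)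
        ≡⟨ cong (length (cubeSets false) +_) (length-++ (cubeSets true)) ⟩
      length (cubeSets false) + (length (cubeSets true) + length (map (∁ ∘ ⁅_⁆) highVertices))
        ≡⟨ ≡.cong₂ _+_ (length-cubeSets false)
                       (≡.cong₂ _+_ (length-cubeSets true) (length-map (∁ ∘ ⁅_⁆) highVertices)) ⟩
      suc K + (suc K + numDeg≥3 G)
        ≡⟨ ℕ.+-assoc (suc K) (suc K) (numDeg≥3 G) ⟨
      suc K + suc K + numDeg≥3 G
        ≡⟨ cong (λ m → suc K + m + numDeg≥3 G) (ℕ.+-identityʳ (suc K)) ⟨
      2 * suc K + numDeg≥3 G ∎
      where open ≡.≡-Reasoning

  N≤-cubeEmbedding : ∀ {K} → CubeEmbedding (suc K) → N≤ G (2 * suc K + numDeg≥3 G)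
  N≤-cubeEmbedding E = sets E , sets-covering E , ℕ.≤-reflexive (length-sets E)

  -- Counting vertices

  edgeList : List (Fin n × Fin n)
  edgeList = filterᵇ (λ p → (toℕ (proj₁ p) <ᵇ toℕ (proj₂ p)) ∧ adj (proj₁ p) (proj₂ p))
                     (concatMap (λ u → map (λ v → (u , v)) (allFin n)) (allFin n))

  -- Each vertex w contributes the ordered pair (w , nb w), an edge read in one of its two directions.
  vertices≤2*edges : (nb : Fin n → Fin n) → (∀ w → w ~ nb w) → n ≤ edgeCount G + edgeCount G
  vertices≤2*edges nb w~nb = begin
    n                                         ≡⟨ length-tabulate (λ i → i) ⟨
    length (allFin n)                         ≡⟨ length-map dart (allFin n) ⟨
    length (map dart (allFin n))              ≤⟨ Unique⇒length≤ darts-unique dart∈ ⟩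
    length (edgeList ++ map Product.swap edgeList)    ≡⟨ length-++ edgeList ⟩
    length edgeList + length (map Product.swap edgeList) ≡⟨ cong (length edgeList +_) (length-map Product.swap edgeList) ⟩
    edgeCount G + edgeCount G                 ∎
    where
    open ℕ.≤-Reasoning
    dart : Fin n → Fin n × Fin n
    dart w = w , nb w
    darts-unique : Unique (map dart (allFin n))
    darts-unique = Unique.map⁺ (cong proj₁) (Unique.allFin⁺ n)
    edge∈ : ∀ {u v} → toℕ u < toℕ v → u ~ v → (u , v) ∈ edgeList
    edge∈ {u} {v} u<v u~v = ∈-filter⁺ (T? ∘ _) (∈-concat⁺′ (∈-map⁺ (u ,_) (∈-allFin v)) (∈-map⁺ _ (∈-allFin u)))
                                       (Equivalence.from T-∧ (ℕ.<⇒<ᵇ u<v , Equivalence.from T-≡ u~v))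
    dart∈ : ∀ {p} → p ∈ map dart (allFin n) → p ∈ edgeList ++ map Product.swap edgeList
    dart∈ p∈ with ∈-map⁻ dart p∈
    ... | w , _ , refl with ℕ.<-cmp (toℕ w) (toℕ (nb w))
    ...   | tri< w<v _ _ = ∈-++⁺ˡ (edge∈ w<v (w~nb w))
    ...   | tri≈ _ w≡v _ = ⊥-elim (~-irrefl (w~nb w) (toℕ-injective w≡v))
    ...   | tri> _ _ v<w = ∈-++⁺ʳ edgeList (∈-map⁺ Product.swap (edge∈ v<w (~-sym (w~nb w))))

  Reach⇒neighbour : ∀ {u v} → Reach G u v → u ≢ v → ∃ (u ~_)
  Reach⇒neighbour here           u≢u = ⊥-elim (u≢u refl)
  Reach⇒neighbour (step u~w _) _   = _ , u~w

  ∈⇒≤foldr-⊔ : ∀ {x xs} → x ∈ xs → x ≤ foldr _⊔_ 0 xs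
  ∈⇒≤foldr-⊔ {xs = y ∷ ys} (here refl) = ℕ.m≤m⊔n y _
  ∈⇒≤foldr-⊔ {xs = y ∷ ys} (there x∈) = ℕ.≤-trans (∈⇒≤foldr-⊔ x∈) (ℕ.m≤n⊔m y _)

  deg≤maxDeg : ∀ u → deg G u ≤ maxDeg G
  deg≤maxDeg u = ∈⇒≤foldr-⊔ (∈-map⁺ (deg G) (∈-allFin u))

  unique-neighbour : maxDeg G ≤ 1 → ∀ {u v v′} → u ~ v → u ~ v′ → v ≡ v′
  unique-neighbour Δ≤1 {u} {v} {v′} u~v u~v′ with v Fin.≟ v′
  ... | yes v≡v′ = v≡v′
  ... | no  v≢v′ with ℕ.≤-trans (deg-≥ ((v≢v′ ∷ []) ∷ [] ∷ []) (u~v ∷ u~v′ ∷ [])) (ℕ.≤-trans (deg≤maxDeg u) Δ≤1)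
  ...   | s≤s ()

  -- With maximum degree ≤ 1 a connected graph is a single edge (or vertex), so no vertex lies off an edge.
  emptyCovering : Connected G → maxDeg G ≤ 1 → IsCovering G []
  emptyCovering connected Δ≤1 u v x u~v x≢u x≢v = ⊥-elim ([ x≢u , x≢v ]′ (walk (connected x u) (inj₁ refl)))
    where
    walk : ∀ {a b} → Reach G a b → b ≡ u ⊎ b ≡ v → a ≡ u ⊎ a ≡ v
    walk here                b∈uv = b∈uv
    walk (step a~c c⇝b) b∈uv with walk c⇝b b∈uv
    ... | inj₁ refl = inj₂ (unique-neighbour Δ≤1 (~-sym a~c) u~v)
    ... | inj₂ refl = inj₁ (unique-neighbour Δ≤1 (~-sym a~c) (~-sym u~v))

m≤2^⌈log₂m⌉ : ∀ m → m ≤ 2 ^ ⌈log₂ m ⌉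
m≤2^⌈log₂m⌉ = <-rec _ bound
  where
  bound : ∀ m → (∀ {k} → k < m → k ≤ 2 ^ ⌈log₂ k ⌉) → m ≤ 2 ^ ⌈log₂ m ⌉
  bound zero          _   = z≤n
  bound (suc zero)    _   = s≤s z≤n
  bound m@(suc (suc k)) rec = go ⌈log₂ m ⌉ refl
    where
    go : ∀ l → ⌈log₂ m ⌉ ≡ l → m ≤ 2 ^ l
    go zero    log≡0 with subst (⌈log₂ 2 ⌉ ≤_) log≡0 (⌈log₂⌉-mono-≤ {2} {m} (s≤s (s≤s z≤n)))
    ... | ()
    go (suc l) log≡1+l = begin
      m                   ≡⟨ ℕ.⌊n/2⌋+⌈n/2⌉≡n m ⟨
      ⌊ m /2⌋ + ⌈ m /2⌉   ≤⟨ ℕ.+-monoˡ-≤ ⌈ m /2⌉ (ℕ.⌊n/2⌋≤⌈n/2⌉ m) ⟩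
      ⌈ m /2⌉ + ⌈ m /2⌉   ≤⟨ ℕ.+-mono-≤ half≤ half≤ ⟩
      2 ^ l + 2 ^ l       ≡⟨ 2^l+2^l≡2^[1+l] l ⟩
      2 ^ suc l           ∎
      where
      open ℕ.≤-Reasoning
      half≤ : ⌈ m /2⌉ ≤ 2 ^ l
      half≤ = subst (λ e → ⌈ m /2⌉ ≤ 2 ^ e) (≡.trans (⌈log₂⌈n/2⌉⌉≡⌈log₂n⌉∸1 m) (cong (_∸ 1) log≡1+l))
                (rec (ℕ.⌈n/2⌉<n k))

vertices≤2^[1+⌈log₂edges⌉] : ∀ {n} (T : Graph n) → IsTree T → n ≤ 2 ^ suc ⌈log₂ edgeCount T ⌉
vertices≤2^[1+⌈log₂edges⌉] {zero}        T (() , _)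
vertices≤2^[1+⌈log₂edges⌉] {suc zero}    T _                  = ℕ.m^n>0 2 (suc ⌈log₂ edgeCount T ⌉)
vertices≤2^[1+⌈log₂edges⌉] {suc (suc k)} T (_ , connected , _) = begin
  suc (suc k)                 ≤⟨ vertices≤2*edges T (proj₁ ∘ neighbour) (proj₂ ∘ neighbour) ⟩
  edgeCount T + edgeCount T   ≤⟨ ℕ.+-mono-≤ (m≤2^⌈log₂m⌉ (edgeCount T)) (m≤2^⌈log₂m⌉ (edgeCount T)) ⟩
  2 ^ K + 2 ^ K               ≡⟨ 2^l+2^l≡2^[1+l] K ⟩
  2 ^ suc K                   ∎
  where
  open ℕ.≤-Reasoning
  K = ⌈log₂ edgeCount T ⌉
  neighbour : ∀ w → ∃ (Adj T w)
  neighbour w = Reach⇒neighbour T (connected w (punchIn w zero)) (punchInᵢ≢i w zero ∘ sym)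

theorem3p9 : ∀ {n : ℕ} (T : Graph n) → IsTree T → ∀ r → IsR (maxDeg T) r →
    N≤ T (2 * ⌈log₂ edgeCount T ⌉ + r + numDeg≥3 T)
theorem3p9 T (_ , connected , _) zero       (Δ≤1 , _) = [] , emptyCovering T connected Δ≤1 , z≤n
theorem3p9 T (_ , connected , _) (suc zero) (Δ≤1 , _) = [] , emptyCovering T connected Δ≤1 , z≤n
theorem3p9 T tree@(_ , _ , acyclic) (suc (suc r)) _
  with N≤-cubeEmbedding T (cubeEmbedding T acyclic (vertices≤2^[1+⌈log₂edges⌉] T tree))
... | As , covering , length≤ = As , covering , ℕ.≤-trans length≤ (ℕ.+-monoˡ-≤ (numDeg≥3 T) 2*[1+K]≤2*K+[2+r])
  where
  K = ⌈log₂ edgeCount T ⌉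
  2*[1+K]≤2*K+[2+r] : 2 * suc K ≤ 2 * K + suc (suc r)
  2*[1+K]≤2*K+[2+r] = begin
    2 * suc K         ≡⟨ ℕ.*-suc 2 K ⟩
    2 + 2 * K         ≤⟨ ℕ.+-monoˡ-≤ (2 * K) (ℕ.m≤m+n 2 r) ⟩
    2 + r + 2 * K     ≡⟨ ℕ.+-comm (2 + r) (2 * K) ⟩
    2 * K + (2 + r)   ∎
    where open ℕ.≤-Reasoning
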